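{- Let $p$ be a prime, $n\ge1$, and $\alpha_1,\dots,\alpha_n,\beta\in\mathbb Z_p$ with $\alpha_n\ne0$. Then the function $\mathbb Z_p^n\to\mathbb{R}$, $(x_1,\dots,x_n)\mapsto\alpha_1x_1\oplus\dots\oplus\alpha_nx_n\oplus\beta$ (value in $\{0,\dots,p-1\}$ regarded as a real number) is a real linear combination of the functions in $\mathcal F_{n-1}$.
   Context: $\oplus$ denotes addition modulo $p$. For $0\le\ell\le n-1$, $F_\ell$ is the set of functions $(x_1,\dots,x_n)\mapsto\alpha_1x_1\oplus\dots\oplus\alpha_\ell x_\ell\oplus x_{\ell+1}\oplus\beta$ with $\alpha_i\in\{0,\dots,p-1\}$, $\beta\in\{0,\dots,p-2\}$ (values in $\{0,\dots,p-1\}$ regarded as reals), and $\mathcal F_{n-1}=F_{n-1}\cup\dots\cup F_0\cup\{1\}$ with $1$ the constant function. -}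

module Defs where

open import Data.Nat using (ℕ; zero; suc; _+_; _*_; _∸_; NonZero)
open import Data.Nat.DivMod using (_%_)
open import Data.Fin using (Fin; toℕ; inject!; inject₁)
open import Data.List using (List; []; _∷_; tabulate)
open import Data.Nat.ListAction using (sum)
open import Data.Product using (_×_; _,_)
open import Data.Integer using (+_)
open import Data.Rational using (ℚ; _/_; 0ℚ; 1ℚ) renaming (_+_ to _+ℚ_; _*_ to _*ℚ_)

Point : ℕ → ℕ → Set
Point p n = Fin n → Fin p

-- Value in {0,…,p-1} of  a₀ x₀ ⊕ … ⊕ a_{k-1} x_{k-1} ⊕ c  (mod p), as a natural number.
-- (Computing the ordinary sum and reducing once mod p equals iterated addition mod p.)
linSum : (p k : ℕ) → (Fin k → Fin p) → (Fin k → Fin p) → ℕ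
linSum p k a x = sum (tabulate (λ i → toℕ (a i) * toℕ (x i)))

-- embedding of a natural number into ℚ (the paper's "regarded as a real")
toℚ : ℕ → ℚ
toℚ k = + k / 1

target : (p n : ℕ) .{{_ : NonZero p}} → (Fin n → Fin p) → Fin p → Point p n → ℚ
target p n α β x = toℚ ((linSum p n α x + toℕ β) % p)

-- Codes for the members of 𝓕_{n-1}, where n = suc m.
-- lin ℓ α β  encodes  x ↦ α₁x₁ ⊕ … ⊕ α_ℓ x_ℓ ⊕ x_{ℓ+1} ⊕ β  ∈ F_ℓ  (0 ≤ ℓ ≤ n-1),
--   with α : Fin ℓ → ℤ_p and β ∈ {0,…,p-2} (i.e. β : Fin (p ∸ 1)).
-- one encodes the constant function 1.
-- (Variables are 0-indexed: x_{i+1} of the paper is x (i) here.)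
data FCode (p m : ℕ) : Set where
  one : FCode p m
  lin : (ℓ : Fin (suc m)) → (Fin (toℕ ℓ) → Fin p) → Fin (p ∸ 1) → FCode p m

evalF : (p m : ℕ) .{{_ : NonZero p}} → FCode p m → Point p (suc m) → ℚ
evalF p m one x = 1ℚ
evalF p m (lin ℓ α β) x =
  toℚ ((linSum p (toℕ ℓ) α (λ i → x (inject₁ (inject! i))) + toℕ (x ℓ) + toℕ β) % p)

evalComb : (p m : ℕ) .{{_ : NonZero p}} → List (ℚ × FCode p m) → Point p (suc m) → ℚ
evalComb p m [] x = 0ℚ
evalComb p m ((c , f) ∷ cs) x = (c *ℚ evalF p m f x) +ℚ evalComb p m cs x

module Submission where

-- Let a = αₙ and γ = a⁻¹ mod p. The form N = Σᵢ (γ αᵢ mod p) xᵢ has coefficient 1 on xₙ, and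
-- the target is ψ (N mod p) with ψ v = (a v + β) mod p. The members of F_{n-1} with these
-- coefficients are the shifts g_b = (N + b) mod p, b ≤ p - 2, and g_j + 1 - g_{j+1} is p
-- where N ≡ p - 1 - j and 0 elsewhere. So 1, g_0 = N mod p and these differences span all
-- functions of w = N mod p:  ψ w = ψ 0 + (ψ 1 - ψ 0) w + Σ_{2 ≤ v < p} e v [w = v],
-- where e v is the deviation of ψ v from that line.

open import Defs
open import Function using (_∘_)
open import Data.Empty using (⊥-elim)
open import Data.Product using (Σ; ∃; _×_; _,_; proj₁; proj₂)
open import Data.List using (List; []; _∷_; tabulate)
open import Data.Nat.ListAction using (sum)
open import Data.Nat as ℕ
  using (ℕ; zero; suc; _+_; _*_; _∸_; _≤_; _<_; _≟_; NonZero; z≤n; s≤s; z<s)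
open import Data.Nat.Properties
open import Data.Nat.DivMod
  using (_%_; _/_; _mod_; %-distribˡ-+; %-distribˡ-*; m%n%n≡m%n; [m+kn]%n≡m%n; m<n⇒m%n≡m; m≤n⇒m%n≡m;
         n%n≡0; m*n%n≡0; %-pred-≡0; m≡m%n+[m/n]*n; m%n<n)
open import Data.Nat.Primality using (Prime; ¬prime[0]; ¬prime[1])
open import Data.Nat.Coprimality using (prime⇒coprime; coprime-Bézout)
open import Data.Nat.GCD using (module Bézout)
open import Data.Fin using (Fin; toℕ; fromℕ; inject₁; inject!)
open import Data.Fin.Properties using (toℕ-fromℕ<; toℕ<n)
import Data.Integer as ℤ
import Data.Integer.Properties as ℤ
open import Data.Rational as ℚ using (ℚ; 0ℚ; 1ℚ; 1/_)
open import Data.Rational.Literals using (fromℤ)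
import Data.Rational.Properties as ℚ
open import Data.Rational.Unnormalised using (*≡*)
import Data.Rational.Unnormalised.Properties as ℚᵘ
open import Data.Rational.Solver using (module +-*-Solver)
open import Relation.Nullary using (yes; no; contradiction)
open import Relation.Binary.PropositionalEquality

open +-*-Solver

tabulate-inject!-fromℕ : ∀ {a} {A : Set a} k (f : Fin k → A) →
  tabulate (f ∘ inject! {i = fromℕ k}) ≡ tabulate f
tabulate-inject!-fromℕ zero    f = refl
tabulate-inject!-fromℕ (suc k) f =
  cong (f Fin.zero ∷_) (tabulate-inject!-fromℕ k (f ∘ Fin.suc))

linSum-inject! : ∀ p k (a x : Fin k → Fin p) →
  linSum p (toℕ (fromℕ k)) (a ∘ inject!) (x ∘ inject!) ≡ linSum p k a x
linSum-inject! p k a x =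
  cong sum (tabulate-inject!-fromℕ k (λ i → toℕ (a i) * toℕ (x i)))

linSum-last : ∀ p k (a x : Fin (suc k) → Fin p) →
  linSum p (suc k) a x ≡
  linSum p k (a ∘ inject₁) (x ∘ inject₁) + toℕ (a (fromℕ k)) * toℕ (x (fromℕ k))
linSum-last p zero    a x = +-comm _ 0
linSum-last p (suc k) a x = trans
  (cong (toℕ (a Fin.zero) * toℕ (x Fin.zero) +_)
        (linSum-last p k (a ∘ Fin.suc) (x ∘ Fin.suc)))
  (sym (+-assoc (toℕ (a Fin.zero) * toℕ (x Fin.zero)) _ _))

monicForm : (p m : ℕ) → (Fin (toℕ (fromℕ m)) → Fin p) → Point p (suc m) → ℕ
monicForm p m A x =
  linSum p (toℕ (fromℕ m)) A (λ i → x (inject₁ (inject! i))) + toℕ (x (fromℕ m))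

module Congruence (P : ℕ) .{{_ : NonZero P}} where

  infix 4 _≡ₘ_
  _≡ₘ_ : ℕ → ℕ → Set
  a ≡ₘ b = a % P ≡ b % P

  %-≡ₘ : ∀ a → a % P ≡ₘ a
  %-≡ₘ a = m%n%n≡m%n a P

  +-congₘ : ∀ {a b c d} → a ≡ₘ b → c ≡ₘ d → a + c ≡ₘ b + d
  +-congₘ {a} {b} {c} {d} a≡b c≡d = begin
    (a + c) % P            ≡⟨ %-distribˡ-+ a c P ⟩
    (a % P + c % P) % P    ≡⟨ cong₂ (λ u v → (u + v) % P) a≡b c≡d ⟩
    (b % P + d % P) % P    ≡⟨ %-distribˡ-+ b d P ⟨
    (b + d) % P            ∎
    where open ≡-Reasoning

  *-congₘ : ∀ {a b c d} → a ≡ₘ b → c ≡ₘ d → a * c ≡ₘ b * d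
  *-congₘ {a} {b} {c} {d} a≡b c≡d = begin
    (a * c) % P            ≡⟨ %-distribˡ-* a c P ⟩
    (a % P * (c % P)) % P  ≡⟨ cong₂ (λ u v → (u * v) % P) a≡b c≡d ⟩
    (b % P * (d % P)) % P  ≡⟨ %-distribˡ-* b d P ⟨
    (b * d) % P            ∎
    where open ≡-Reasoning

  linSum-scale : ∀ k c (b a x : Fin k → Fin P) →
    (∀ i → c * toℕ (b i) ≡ₘ toℕ (a i)) →
    c * linSum P k b x ≡ₘ linSum P k a x
  linSum-scale zero    c b a x cb≡a = cong (_% P) (*-zeroʳ c)
  linSum-scale (suc k) c b a x cb≡a = begin
    (c * (b₀ * x₀ + rest b)) % P       ≡⟨ cong (_% P) (*-distribˡ-+ c (b₀ * x₀) (rest b)) ⟩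
    (c * (b₀ * x₀) + c * rest b) % P   ≡⟨ cong (λ u → (u + c * rest b) % P) (*-assoc c b₀ x₀) ⟨
    (c * b₀ * x₀ + c * rest b) % P     ≡⟨ +-congₘ (*-congₘ (cb≡a Fin.zero) refl)
                                                  (linSum-scale k c (b ∘ Fin.suc) (a ∘ Fin.suc) (x ∘ Fin.suc) (cb≡a ∘ Fin.suc)) ⟩
    (toℕ (a Fin.zero) * x₀ + rest a) % P ∎
    where
    open ≡-Reasoning
    b₀ = toℕ (b Fin.zero)
    x₀ = toℕ (x Fin.zero)
    rest : (Fin (suc k) → Fin P) → ℕ
    rest v = linSum P k (v ∘ Fin.suc) (x ∘ Fin.suc)

toℚ≡fromℤ : ∀ k → toℚ k ≡ fromℤ (ℤ.+ k)
toℚ≡fromℤ k = ℚ.normalize-coprime _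

toℚ-+ : ∀ a b → toℚ (a + b) ≡ toℚ a ℚ.+ toℚ b
toℚ-+ a b rewrite toℚ≡fromℤ (a + b) | toℚ≡fromℤ a | toℚ≡fromℤ b =
  ℚ.toℚᵘ-injective (ℚᵘ.≃-trans (*≡* numerators)
                              (ℚᵘ.≃-sym (ℚ.toℚᵘ-homo-+ (fromℤ (ℤ.+ a)) (fromℤ (ℤ.+ b)))))
  where
  numerators : ℤ.+ (a + b) ℤ.* ℤ.+ 1 ≡ (ℤ.+ a ℤ.* ℤ.+ 1 ℤ.+ ℤ.+ b ℤ.* ℤ.+ 1) ℤ.* ℤ.+ 1
  numerators = begin
    ℤ.+ (a + b) ℤ.* ℤ.+ 1                                ≡⟨ ℤ.*-identityʳ _ ⟩
    ℤ.+ (a + b)                                          ≡⟨ ℤ.pos-+ a b ⟩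
    ℤ.+ a ℤ.+ ℤ.+ b                                      ≡⟨ cong₂ ℤ._+_ (ℤ.*-identityʳ (ℤ.+ a)) (ℤ.*-identityʳ (ℤ.+ b)) ⟨
    ℤ.+ a ℤ.* ℤ.+ 1 ℤ.+ ℤ.+ b ℤ.* ℤ.+ 1                  ≡⟨ ℤ.*-identityʳ _ ⟨
    (ℤ.+ a ℤ.* ℤ.+ 1 ℤ.+ ℤ.+ b ℤ.* ℤ.+ 1) ℤ.* ℤ.+ 1      ∎
    where open ≡-Reasoning

toℚ-*-1/ : ∀ k → toℚ (suc k) ℚ.* 1/ fromℤ (ℤ.+ suc k) ≡ 1ℚ
toℚ-*-1/ k rewrite toℚ≡fromℤ (suc k) = ℚ.*-inverseʳ (fromℤ (ℤ.+ suc k))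

toℚ-+1-diff : ∀ {a b} c → a + 1 ≡ b + c → toℚ a ℚ.+ 1ℚ ℚ.- toℚ b ≡ toℚ c
toℚ-+1-diff {a} {b} c a+1≡b+c = begin
  toℚ a ℚ.+ 1ℚ ℚ.- toℚ b           ≡⟨ cong (ℚ._- toℚ b) (toℚ-+ a 1) ⟨
  toℚ (a + 1) ℚ.- toℚ b            ≡⟨ cong (λ n → toℚ n ℚ.- toℚ b) a+1≡b+c ⟩
  toℚ (b + c) ℚ.- toℚ b            ≡⟨ cong (ℚ._- toℚ b) (toℚ-+ b c) ⟩
  toℚ b ℚ.+ toℚ c ℚ.- toℚ b        ≡⟨ solve 2 (λ u v → u :+ v :- u := v) refl (toℚ b) (toℚ c) ⟩
  toℚ c                            ∎
  where open ≡-Reasoning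

δ : ℕ → ℕ → ℚ
δ i j with i ≟ j
... | yes _ = 1ℚ
... | no  _ = 0ℚ

Σ< : ℕ → (ℕ → ℚ) → ℚ
Σ< zero    f = 0ℚ
Σ< (suc k) f = f k ℚ.+ Σ< k f

Σ<-δ-outside : ∀ (f : ℕ → ℚ) {t} k → k ≤ t → Σ< k (λ j → f j ℚ.* δ j t) ≡ 0ℚ
Σ<-δ-outside f zero    _   = refl
Σ<-δ-outside f {t} (suc k) k<t with k ≟ t
... | yes refl = contradiction k<t (n≮n k)
... | no  _    = begin
  f k ℚ.* 0ℚ ℚ.+ Σ< k (λ j → f j ℚ.* δ j t)  ≡⟨ cong₂ ℚ._+_ (ℚ.*-zeroʳ (f k)) (Σ<-δ-outside f k (<⇒≤ k<t)) ⟩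
  0ℚ ℚ.+ 0ℚ                                  ∎
  where open ≡-Reasoning

Σ<-δ-inside : ∀ (f : ℕ → ℚ) {t} k → t < k → Σ< k (λ j → f j ℚ.* δ j t) ≡ f t
Σ<-δ-inside f {t} (suc k) t<1+k with k ≟ t
... | yes refl = begin
  f k ℚ.* 1ℚ ℚ.+ Σ< k (λ j → f j ℚ.* δ j k)  ≡⟨ cong₂ ℚ._+_ (ℚ.*-identityʳ (f k)) (Σ<-δ-outside f k ≤-refl) ⟩
  f k ℚ.+ 0ℚ                                 ≡⟨ ℚ.+-identityʳ (f k) ⟩
  f k                                        ∎
  where open ≡-Reasoning
... | no k≢t = begin
  f k ℚ.* 0ℚ ℚ.+ Σ< k (λ j → f j ℚ.* δ j t)  ≡⟨ cong₂ ℚ._+_ (ℚ.*-zeroʳ (f k))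
                                                      (Σ<-δ-inside f k (≤∧≢⇒< (≤-pred t<1+k) (k≢t ∘ sym))) ⟩
  0ℚ ℚ.+ f t                                 ≡⟨ ℚ.+-identityˡ (f t) ⟩
  f t                                        ∎
  where open ≡-Reasoning

module Interpolation (q : ℕ) (ψ : ℕ → ℚ) where

  slope : ℚ
  slope = ψ 1 ℚ.- ψ 0

  defect : ℕ → ℚ
  defect v = ψ v ℚ.- (ψ 0 ℚ.+ slope ℚ.* toℚ v)

  Σ-defect : ∀ {w} → w ≤ suc q →
    Σ< q (λ j → defect (suc q ∸ j) ℚ.* δ j (suc q ∸ w)) ≡ defect w
  Σ-defect {zero} _ = trans (Σ<-δ-outside (defect ∘ (suc q ∸_)) q (n≤1+n q))
    (solve 2 (λ a b → con 0ℚ := a :- (a :+ (b :- a) :* con 0ℚ)) refl (ψ 0) (ψ 1))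
  Σ-defect {suc zero} _ = trans (Σ<-δ-outside (defect ∘ (suc q ∸_)) q ≤-refl)
    (solve 2 (λ a b → con 0ℚ := b :- (a :+ (b :- a) :* con 1ℚ)) refl (ψ 0) (ψ 1))
  Σ-defect {suc (suc u)} w≤P-1 = trans
    (Σ<-δ-inside (defect ∘ (suc q ∸_)) q (∸-monoʳ-< {q} {suc u} {0} z<s (≤-pred w≤P-1)))
    (cong defect (m∸[m∸n]≡n w≤P-1))

  interpolation : ∀ {w} → w ≤ suc q →
    ψ 0 ℚ.+ slope ℚ.* toℚ w ℚ.+ Σ< q (λ j → defect (suc q ∸ j) ℚ.* δ j (suc q ∸ w)) ≡ ψ w
  interpolation {w} w≤P-1 rewrite Σ-defect w≤P-1 =
    solve 2 (λ l v → l :+ (v :- l) := v) refl (ψ 0 ℚ.+ slope ℚ.* toℚ w) (ψ w)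

-- Throughout, p = q + 2: so suc q is p - 1, and Fin (p ∸ 1) is Fin (suc q).
module Residues (q : ℕ) where

  P : ℕ
  P = suc (suc q)

  open Congruence P

  -- In the second Bézout case y * a ≡ -1, and (P - 1)² ≡ 1.
  inverse : Prime P → ∀ {a} → .{{NonZero a}} → a < P → ∃ λ γ → a * γ ≡ₘ 1
  inverse pr {a} a<P with coprime-Bézout (prime⇒coprime pr a<P)
  ... | Bézout.-+ x y 1+xP≡ya = y , (begin
    (a * y) % P          ≡⟨ cong (_% P) (trans (*-comm a y) (sym 1+xP≡ya)) ⟩
    (1 + x * P) % P      ≡⟨ [m+kn]%n≡m%n 1 x P ⟩
    1 % P                ∎)
    where open ≡-Reasoning
  ... | Bézout.+- x y 1+ya≡xP = y * suc q , (begin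
    (a * (y * suc q)) % P       ≡⟨ cong (_% P) (trans (sym (*-assoc a y (suc q))) (cong (_* suc q) (*-comm a y))) ⟩
    (y * a * suc q) % P         ≡⟨ *-congₘ {y * a} {suc q} {suc q} {suc q} ya≡P-1 refl ⟩
    (suc q * suc q) % P         ≡⟨ cong (λ n → suc n % P) (*-suc q (suc q)) ⟨
    (1 + q * P) % P             ≡⟨ [m+kn]%n≡m%n 1 q P ⟩
    1 % P                       ∎)
    where
    open ≡-Reasoning
    ya≡P-1 : y * a ≡ₘ suc q
    ya≡P-1 = trans (%-pred-≡0 {y * a} (trans (cong (_% P) 1+ya≡xP) (m*n%n≡0 x P)))
                   (sym (m<n⇒m%n≡m (n<1+n (suc q))))

  %≡P-1⇒≡P-1 : ∀ {n} → n < P + suc q → n % P ≡ suc q → n ≡ suc q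
  %≡P-1⇒≡P-1 {n} n<P+P-1 n%P≡P-1 with n / P | m≡m%n+[m/n]*n n P
  ... | zero  | n≡ = trans n≡ (trans (+-identityʳ (n % P)) n%P≡P-1)
  ... | suc k | n≡ = contradiction n<P+P-1 (≤⇒≯ (begin
    P + suc q             ≡⟨ +-comm P (suc q) ⟩
    suc q + P             ≤⟨ +-monoʳ-≤ (suc q) (m≤m+n P (k * P)) ⟩
    suc q + suc k * P     ≡⟨ cong (_+ suc k * P) n%P≡P-1 ⟨
    n % P + suc k * P     ≡⟨ n≡ ⟨
    n                     ∎))
    where open ≤-Reasoning

  suc-% : ∀ n → suc n % P ≡ suc (n % P) % P
  suc-% n = +-congₘ {1} {1} {n} {n % P} refl (sym (%-≡ₘ n))

  +-suc-%-wrap : ∀ w j → w + j ≡ suc q → (w + j) % P + 1 ≡ (w + suc j) % P + P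
  +-suc-%-wrap w j w+j≡P-1 = begin
    (w + j) % P + 1       ≡⟨ cong (λ n → n % P + 1) w+j≡P-1 ⟩
    suc q % P + 1         ≡⟨ cong (_+ 1) (m<n⇒m%n≡m (n<1+n (suc q))) ⟩
    suc q + 1             ≡⟨ +-comm (suc q) 1 ⟩
    0 + P                 ≡⟨ cong (_+ P) (n%n≡0 P) ⟨
    P % P + P             ≡⟨ cong (λ n → n % P + P) (trans (+-suc w j) (cong suc w+j≡P-1)) ⟨
    (w + suc j) % P + P   ∎
    where open ≡-Reasoning

  +-suc-%-nowrap : ∀ {w j} → w < P → j < P → w + j ≢ suc q →
    (w + j) % P + 1 ≡ (w + suc j) % P
  +-suc-%-nowrap {w} {j} w<P j<P w+j≢P-1 = begin
    (w + j) % P + 1       ≡⟨ +-comm _ 1 ⟩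
    suc ((w + j) % P)     ≡⟨ m<n⇒m%n≡m (s≤s r<P-1) ⟨
    suc ((w + j) % P) % P ≡⟨ suc-% (w + j) ⟨
    suc (w + j) % P       ≡⟨ cong (_% P) (+-suc w j) ⟨
    (w + suc j) % P       ∎
    where
    open ≡-Reasoning
    r<P-1 : (w + j) % P < suc q
    r<P-1 = ≤∧≢⇒< (≤-pred (m%n<n (w + j) P))
                  (w+j≢P-1 ∘ %≡P-1⇒≡P-1 (+-mono-<-≤ w<P (≤-pred j<P)))

  residue-jump : ∀ {w j} → w < P → j < P →
    toℚ ((w + j) % P) ℚ.+ 1ℚ ℚ.- toℚ ((w + suc j) % P) ≡ toℚ P ℚ.* δ j (suc q ∸ w)
  residue-jump {w} {j} w<P j<P with j ≟ suc q ∸ w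
  ... | yes j≡P-1-w = trans
    (toℚ-+1-diff {(w + j) % P} {(w + suc j) % P} P (+-suc-%-wrap w j (trans (cong (w +_) j≡P-1-w) (m+[n∸m]≡n (≤-pred w<P)))))
    (sym (ℚ.*-identityʳ (toℚ P)))
  ... | no j≢P-1-w = trans
    (toℚ-+1-diff {(w + j) % P} {(w + suc j) % P} 0 (trans (+-suc-%-nowrap w<P j<P (j≢P-1-w ∘ solve-j)) (sym (+-identityʳ _))))
    (sym (ℚ.*-zeroʳ (toℚ P)))
    where
    solve-j : w + j ≡ suc q → j ≡ suc q ∸ w
    solve-j w+j≡P-1 = trans (sym (m+n∸m≡n w j)) (cong (_∸ w) w+j≡P-1)

  monic-rescaling : Prime P → ∀ m (α : Fin (suc m) → Fin P) → toℕ (α (fromℕ m)) ≢ 0 →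
    Σ (Fin (toℕ (fromℕ m)) → Fin P) λ A →
      ∀ x → linSum P (suc m) α x ≡ₘ toℕ (α (fromℕ m)) * monicForm P m A x
  monic-rescaling pr m α a≢0 = B ∘ inject₁ ∘ inject! , λ x → begin
    linSum P (suc m) α x % P
      ≡⟨ linSum-scale (suc m) a B α x rescaled ⟨
    (a * linSum P (suc m) B x) % P
      ≡⟨ cong (λ s → (a * s) % P) (linSum-last P m B x) ⟩
    (a * (linSum P m (B ∘ inject₁) (x ∘ inject₁) + toℕ (B (fromℕ m)) * toℕ (x (fromℕ m)))) % P
      ≡⟨ cong₂ (λ s t → (a * (s + t)) % P)
               (sym (linSum-inject! P m (B ∘ inject₁) (x ∘ inject₁)))
               (trans (cong (_* toℕ (x (fromℕ m))) B-last≡1) (*-identityˡ (toℕ (x (fromℕ m))))) ⟩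
    (a * monicForm P m (B ∘ inject₁ ∘ inject!) x) % P ∎
    where
    open ≡-Reasoning
    a = toℕ (α (fromℕ m))
    instance
      a-nonZero : NonZero a
      a-nonZero = ℕ.≢-nonZero a≢0
    inv = inverse pr (toℕ<n (α (fromℕ m)))
    γ = proj₁ inv
    B : Fin (suc m) → Fin P
    B i = (γ * toℕ (α i)) mod P
    B-last≡1 : toℕ (B (fromℕ m)) ≡ 1
    B-last≡1 = begin
      toℕ ((γ * a) mod P)  ≡⟨ toℕ-fromℕ< _ ⟩
      (γ * a) % P          ≡⟨ cong (_% P) (*-comm γ a) ⟩
      (a * γ) % P          ≡⟨ proj₂ inv ⟩
      1 % P                ≡⟨ m<n⇒m%n≡m {n = P} (s≤s (s≤s z≤n)) ⟩
      1                    ∎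
    rescaled : ∀ i → a * toℕ (B i) ≡ₘ toℕ (α i)
    rescaled i = begin
      (a * toℕ ((γ * αᵢ) mod P)) % P  ≡⟨ cong (λ b → (a * b) % P) (toℕ-fromℕ< _) ⟩
      (a * ((γ * αᵢ) % P)) % P        ≡⟨ *-congₘ {a} {a} {(γ * αᵢ) % P} {γ * αᵢ} refl (%-≡ₘ (γ * αᵢ)) ⟩
      (a * (γ * αᵢ)) % P              ≡⟨ cong (_% P) (*-assoc a γ αᵢ) ⟨
      (a * γ * αᵢ) % P                ≡⟨ *-congₘ {a * γ} {1} {αᵢ} {αᵢ} (proj₂ inv) refl ⟩
      (1 * αᵢ) % P                    ≡⟨ cong (_% P) (*-identityˡ αᵢ) ⟩
      αᵢ % P                          ∎
      where αᵢ = toℕ (α i)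

module Shifts (q m : ℕ) (A : Fin (toℕ (fromℕ m)) → Fin (suc (suc q))) where

  open Residues q
  open Congruence P

  N : Point P (suc m) → ℕ
  N = monicForm P m A

  shift : ℕ → FCode P m
  shift b = lin (fromℕ m) A (b mod suc q)

  evalF-shift : ∀ {b} → b ≤ q → ∀ x → evalF P m (shift b) x ≡ toℚ ((N x % P + b) % P)
  evalF-shift {b} b≤q x = cong toℚ (begin
    (N x + toℕ (b mod suc q)) % P  ≡⟨ cong (λ c → (N x + c) % P) (trans (toℕ-fromℕ< _) (m≤n⇒m%n≡m b≤q)) ⟩
    (N x + b) % P                  ≡⟨ +-congₘ {N x} {N x % P} {b} {b} (sym (%-≡ₘ (N x))) refl ⟩
    (N x % P + b) % P              ∎)
    where open ≡-Reasoning

  blocks : (ℕ → ℚ) → ℕ → List (ℚ × FCode P m)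
  blocks d zero    = []
  blocks d (suc j) = (e , shift j) ∷ (ℚ.- e , shift (suc j)) ∷ (e , one) ∷ blocks d j
    where e = d j ℚ.* 1/ fromℤ (ℤ.+ P)

  evalComb-blocks : ∀ d {k} → k ≤ q → ∀ x →
    evalComb P m (blocks d k) x ≡ Σ< k (λ j → d j ℚ.* δ j (suc q ∸ N x % P))
  evalComb-blocks d {zero}  _   x = refl
  evalComb-blocks d {suc j} j<q x = begin
    e ℚ.* S j ℚ.+ ((ℚ.- e) ℚ.* S (suc j) ℚ.+ (e ℚ.* 1ℚ ℚ.+ rest))
      ≡⟨ solve 5 (λ dj i a b r → (dj :* i) :* a :+ ((:- (dj :* i)) :* b :+ ((dj :* i) :* con 1ℚ :+ r))
                                  := dj :* (i :* (a :+ con 1ℚ :- b)) :+ r)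
                 refl (d j) 1/P (S j) (S (suc j)) rest ⟩
    d j ℚ.* (1/P ℚ.* (S j ℚ.+ 1ℚ ℚ.- S (suc j))) ℚ.+ rest
      ≡⟨ cong₂ (λ u v → d j ℚ.* (1/P ℚ.* u) ℚ.+ v) difference (evalComb-blocks d (<⇒≤ j<q) x) ⟩
    d j ℚ.* (1/P ℚ.* (toℚ P ℚ.* δ j t)) ℚ.+ Σ< j (λ i → d i ℚ.* δ i t)
      ≡⟨ cong (λ u → d j ℚ.* u ℚ.+ Σ< j (λ i → d i ℚ.* δ i t)) cancel ⟩
    d j ℚ.* δ j t ℚ.+ Σ< j (λ i → d i ℚ.* δ i t) ∎
    where
    open ≡-Reasoning
    w = N x % P
    t = suc q ∸ w
    1/P = 1/ fromℤ (ℤ.+ P)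
    e = d j ℚ.* 1/P
    S : ℕ → ℚ
    S b = evalF P m (shift b) x
    rest = evalComb P m (blocks d j) x
    j<P : j < P
    j<P = m<n⇒m<1+n (m<n⇒m<1+n j<q)
    difference : S j ℚ.+ 1ℚ ℚ.- S (suc j) ≡ toℚ P ℚ.* δ j t
    difference = trans (cong₂ (λ u v → u ℚ.+ 1ℚ ℚ.- v) (evalF-shift (<⇒≤ j<q) x) (evalF-shift j<q x))
                       (residue-jump (m%n<n (N x) P) j<P)
    cancel : 1/P ℚ.* (toℚ P ℚ.* δ j t) ≡ δ j t
    cancel = begin
      1/P ℚ.* (toℚ P ℚ.* δ j t)   ≡⟨ ℚ.*-assoc 1/P (toℚ P) (δ j t) ⟨
      1/P ℚ.* toℚ P ℚ.* δ j t     ≡⟨ cong (ℚ._* δ j t) (trans (ℚ.*-comm 1/P (toℚ P)) (toℚ-*-1/ (suc q))) ⟩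
      1ℚ ℚ.* δ j t                ≡⟨ ℚ.*-identityˡ (δ j t) ⟩
      δ j t                       ∎

  span : (ψ : ℕ → ℚ) →
    Σ (List (ℚ × FCode P m)) λ cs → ∀ x → evalComb P m cs x ≡ ψ (N x % P)
  span ψ = (ψ 0 , one) ∷ (slope , shift 0) ∷ blocks d q , λ x →
    let w = N x % P
        Σδ = Σ< q (λ j → d j ℚ.* δ j (suc q ∸ w))
    in begin
    ψ 0 ℚ.* 1ℚ ℚ.+ (slope ℚ.* evalF P m (shift 0) x ℚ.+ evalComb P m (blocks d q) x)
      ≡⟨ cong₂ (λ u v → ψ 0 ℚ.* 1ℚ ℚ.+ (slope ℚ.* u ℚ.+ v))
               (trans (evalF-shift z≤n x) (cong toℚ (trans (cong (_% P) (+-identityʳ w)) (%-≡ₘ (N x)))))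
               (evalComb-blocks d ≤-refl x) ⟩
    ψ 0 ℚ.* 1ℚ ℚ.+ (slope ℚ.* toℚ w ℚ.+ Σδ)
      ≡⟨ solve 3 (λ a b c → a :* con 1ℚ :+ (b :+ c) := a :+ b :+ c) refl (ψ 0) (slope ℚ.* toℚ w) Σδ ⟩
    ψ 0 ℚ.+ slope ℚ.* toℚ w ℚ.+ Σδ
      ≡⟨ interpolation (≤-pred (m%n<n (N x) P)) ⟩
    ψ w ∎
    where
    open Interpolation q ψ
    open ≡-Reasoning
    d : ℕ → ℚ
    d j = defect (suc q ∸ j)

lemma5p27 : (p : ℕ) → Prime p → .{{_ : NonZero p}} → (m : ℕ) →
    (α : Fin (suc m) → Fin p) → (β : Fin p) → toℕ (α (fromℕ m)) ≢ 0 →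
    Σ (List (ℚ × FCode p m)) λ cs →
      (x : Point p (suc m)) → target p (suc m) α β x ≡ evalComb p m cs x
lemma5p27 zero          pr = ⊥-elim (¬prime[0] pr)
lemma5p27 (suc zero)    pr = ⊥-elim (¬prime[1] pr)
lemma5p27 (suc (suc q)) pr m α β α≢0 = proj₁ (span ψ) , λ x → begin
  target P (suc m) α β x
    ≡⟨ cong toℚ (+-congₘ {linSum P (suc m) α x} {a * (N x % P)} {toℕ β} {toℕ β}
                   (trans (proj₂ rescaled x) (*-congₘ {a} {a} {N x} {N x % P} refl (sym (%-≡ₘ (N x)))))
                   refl) ⟩
  ψ (N x % P)
    ≡⟨ proj₂ (span ψ) x ⟨
  evalComb P m (proj₁ (span ψ)) x ∎
  where
  open ≡-Reasoning
  open Residues q using (P)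
  open Congruence P
  a = toℕ (α (fromℕ m))
  ψ : ℕ → ℚ
  ψ v = toℚ ((a * v + toℕ β) % P)
  rescaled = Residues.monic-rescaling q pr m α α≢0
  open Shifts q m (proj₁ rescaled) using (N; span)
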